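{- Let $T$ be a tree of order $n\ge 6$ with $\mathrm{diam}(T)=4$, and let $P_5: v_1v_2v_3v_4v_5$ be a longest path in $T$ such that $\deg_T(v_3)=n-3$. Then $\gamma_{tc}(M(T))=2n-6$.
   Context: All graphs are finite, simple and undirected; $\mathrm{diam}(T)$ is the diameter of $T$. For a graph $H$, a set $D\subseteq V(H)$ is a total dominating set if every vertex of $H$ has a neighbor in $D$. A set $D\subseteq V(H)$ is a total outer-connected dominating set of $H$ if $D$ is a total dominating set and the induced subgraph $H[V(H)\setminus D]$ is connected; $\gamma_{tc}(H)$ denotes the minimum cardinality of a total outer-connected dominating set of $H$. The middle graph $M(G)$ of a graph $G$ has vertex set $V(G)\cup E(G)$, where two elements $x,y$ are adjacent iff either $x,y\in E(G)$ are edges of $G$ sharing an endpoint, or one of them is a vertex of $G$ and the other is an edge of $G$ incident to it. -}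

module Defs where

open import Data.Nat using (ℕ; zero; suc; _≤_; _+_)
open import Data.Fin using (Fin) renaming (_<_ to _<ᶠ_)
open import Data.Bool using (Bool; true; false)
open import Data.List using (List; []; _∷_; _∷ʳ_; length; filterᵇ; allFin)
open import Data.List.Relation.Unary.All using (All)
open import Data.List.Relation.Unary.Unique.Propositional using (Unique)
open import Data.List.Membership.Propositional using (_∈_; _∉_)
open import Data.Product using (Σ; ∃; ∃-syntax; _×_; _,_; proj₁; proj₂)
open import Data.Sum using (_⊎_; inj₁; inj₂)
open import Data.Empty using (⊥)
open import Data.Unit using (⊤)
open import Relation.Binary.PropositionalEquality using (_≡_; _≢_)
open import Relation.Nullary using (¬_)

record Graph : Set₁ where
  field
    V   : Set
    Adj : V → V → Set
open Graph public

-- Walks of length k from x to y all of whose vertices satisfy P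
-- (so walks in the induced subgraph on {v | P v}).
data WalkIn (G : Graph) (P : V G → Set) : V G → V G → ℕ → Set where
  nil  : ∀ {x} → P x → WalkIn G P x x 0
  cons : ∀ {x y z k} → P x → Adj G x y → WalkIn G P y z k → WalkIn G P x z (suc k)

Walk : (G : Graph) → V G → V G → ℕ → Set
Walk G = WalkIn G (λ _ → ⊤)

Connected : Graph → Set
Connected G = ∀ x y → ∃[ k ] Walk G x y k

DistEq : (G : Graph) → V G → V G → ℕ → Set
DistEq G x y d = Walk G x y d × (∀ k → Walk G x y k → d ≤ k)

Diam : Graph → ℕ → Set
Diam G d = (∀ x y → ∃[ k ] (k ≤ d × Walk G x y k))
         × (∃[ x ] ∃[ y ] DistEq G x y d)

-- Total outer-connected dominating set (finite sets as duplicate-free lists)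
TotalDominating : (H : Graph) → List (V H) → Set
TotalDominating H D = ∀ x → ∃[ y ] (y ∈ D × Adj H x y)

OuterConnected : (H : Graph) → List (V H) → Set
OuterConnected H D = ∀ x y → x ∉ D → y ∉ D → ∃[ k ] WalkIn H (λ z → z ∉ D) x y k

IsTOCD : (H : Graph) → List (V H) → Set
IsTOCD H D = TotalDominating H D × OuterConnected H D

GammaTC : (H : Graph) → ℕ → Set
GammaTC H k = (∃[ D ] (Unique D × IsTOCD H D × length D ≡ k))
            × (∀ D → Unique D → IsTOCD H D → k ≤ length D)

record SimpleGraph (n : ℕ) : Set where
  field
    adj    : Fin n → Fin n → Bool
    sym    : ∀ u v → adj u v ≡ adj v u
    irrefl : ∀ u → adj u u ≡ false
open SimpleGraph public

toGraph : ∀ {n} → SimpleGraph n → Graph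
toGraph {n} G = record { V = Fin n ; Adj = λ u v → adj G u v ≡ true }

data IsWalkList {n} (G : SimpleGraph n) : List (Fin n) → Set where
  single : ∀ x → IsWalkList G (x ∷ [])
  step   : ∀ {x y zs} → adj G x y ≡ true → IsWalkList G (y ∷ zs) → IsWalkList G (x ∷ y ∷ zs)

IsPath : ∀ {n} → SimpleGraph n → List (Fin n) → Set
IsPath G ps = IsWalkList G ps × Unique ps

HasCycle : ∀ {n} → SimpleGraph n → Set
HasCycle {n} G = ∃[ x ] ∃[ ys ] (2 ≤ length ys × Unique (x ∷ ys) × IsWalkList G ((x ∷ ys) ∷ʳ x))

IsTree : ∀ {n} → SimpleGraph n → Set
IsTree G = Connected (toGraph G) × ¬ HasCycle G

IsLongestPath : ∀ {n} → SimpleGraph n → List (Fin n) → Set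
IsLongestPath G ps = IsPath G ps × (∀ qs → IsPath G qs → length qs ≤ length ps)

degree : ∀ {n} → SimpleGraph n → Fin n → ℕ
degree {n} G v = length (filterᵇ (adj G v) (allFin n))

-- Middle graph M(G): vertices V(G) ⊎ E(G); an edge is stored as (u , v) with u < v.

Edge : ∀ {n} → SimpleGraph n → Set
Edge {n} G = Σ (Fin n × Fin n) (λ p → (proj₁ p <ᶠ proj₂ p) × adj G (proj₁ p) (proj₂ p) ≡ true)

ends : ∀ {n} {G : SimpleGraph n} → Edge G → Fin n × Fin n
ends e = proj₁ e

Incident : ∀ {n} {G : SimpleGraph n} → Fin n → Edge G → Set
Incident {G = G} x e = x ≡ proj₁ (ends {G = G} e) ⊎ x ≡ proj₂ (ends {G = G} e)

ShareEnd : ∀ {n} {G : SimpleGraph n} → Edge G → Edge G → Set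
ShareEnd {G = G} e f = ∃[ x ] (Incident {G = G} x e × Incident {G = G} x f)

MAdj : ∀ {n} (G : SimpleGraph n) → Fin n ⊎ Edge G → Fin n ⊎ Edge G → Set
MAdj G (inj₁ x) (inj₁ y) = ⊥
MAdj G (inj₁ x) (inj₂ e) = Incident {G = G} x e
MAdj G (inj₂ e) (inj₁ x) = Incident {G = G} x e
MAdj G (inj₂ e) (inj₂ f) = ends {G = G} e ≢ ends {G = G} f × ShareEnd {G = G} e f

Middle : ∀ {n} → SimpleGraph n → Graph
Middle {n} G = record { V = Fin n ⊎ Edge G ; Adj = MAdj G }

-- The hypotheses pin T down: v₃ has degree n − 3 and, T being acyclic, v₃ is adjacent to
-- neither v₁ nor v₅, so v₃ is adjacent to every vertex off {v₁, v₃, v₅}.  Hence T is the spider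
-- with centre v₃, legs v₃v₂v₁ and v₃v₄v₅, and n − 5 further leaves at v₃.  Its n − 3 leaves
-- (all vertices but v₂, v₃, v₄) together with their pendant edges form a total outer-connected
-- dominating set of M(T) of size 2n − 6; its complement is the path v₂, v₂v₃, v₃, v₃v₄, v₄.
-- Conversely, in M(T) a leaf x is adjacent only to its pendant edge, which must therefore lie in
-- every total dominating set D.  If x ∉ D as well, then x is isolated in the complement of D,
-- which being connected is {x}; so |D| ≥ (n − 1) + (n − 3).  Otherwise D contains all leaves and
-- all pendant edges, and |D| ≥ 2n − 6.
module Submission where

open import Defs renaming (sym to adj-sym)
open import Data.Nat using (ℕ; suc; _≤_; _≰_; _<_; _+_; _*_; _∸_; z≤n; s≤s; s≤s⁻¹)
open import Data.Nat.Properties using (≤-trans; ≤-antisym; <⇒≱; +-monoʳ-≤; +-comm; 1+n≰n; m≤n+m∸n; m<m+n; m+n∸n≡m; module ≤-Reasoning)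
open import Data.Nat.Tactic.RingSolver using (solve-∀)
import Data.Bool as Bool
open import Data.Bool using (true)
open import Data.Bool.Properties using (T-≡)
open import Data.Fin using (Fin; punchIn; _≟_)
open import Data.Fin.Properties using (punchIn-injective; punchInᵢ≢i; <-cmp; <-asym; <-irrelevant)
open import Data.List using (List; []; _∷_; length; map; filter; allFin; _++_)
open import Data.List.Properties using (filter-notAll; length-map; length-tabulate; length-++)
open import Data.List.Relation.Unary.All as All using (All; []; _∷_)
import Data.List.Relation.Unary.All.Properties as All
open import Data.List.Relation.Unary.Any as Any using (here; there)
open import Data.List.Relation.Unary.AllPairs using ([]; _∷_)
open import Data.List.Relation.Unary.Unique.Propositional using (Unique)
import Data.List.Relation.Unary.Unique.Propositional.Properties as Unique
open import Data.List.Membership.Propositional using (_∈_; _∉_; find)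
open import Data.List.Membership.Propositional.Properties using (∈-filter⁺; ∈-filter⁻; ∈-map⁺; ∈-map⁻; ∈-allFin; ∈-++⁺ˡ; ∈-++⁺ʳ; ∈-++⁻)
open import Data.List.Relation.Binary.Subset.Propositional using (_⊆_)
open import Data.Product using (∃-syntax; _×_; _,_; proj₁; proj₂)
import Data.Product.Properties as Product
open import Data.Sum using (_⊎_; inj₁; inj₂)
import Data.Sum.Properties as Sum
open import Data.Sum.Properties using (inj₁-injective; inj₂-injective)
open import Data.Empty using (⊥; ⊥-elim)
open import Function using (_∘_)
open import Function.Bundles using (Equivalence)
open import Axiom.UniquenessOfIdentityProofs using (module Decidable⇒UIP)
open import Relation.Binary.Definitions using (DecidableEquality; tri<; tri≈; tri>)
open import Relation.Binary.PropositionalEquality using (_≡_; _≢_; refl; sym; trans; cong; cong₂; subst; subst₂; module ≡-Reasoning)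
open import Relation.Nullary using (¬_; ¬?; Dec; yes; no)
open import Relation.Nullary.Decidable using (T?; map′)

module _ {a} {A : Set a} (_≟_ : DecidableEquality A) where

  Unique∧⊆⇒length≤ : ∀ {xs ys : List A} → Unique xs → xs ⊆ ys → length xs ≤ length ys
  Unique∧⊆⇒length≤ {[]} _ _ = z≤n
  Unique∧⊆⇒length≤ {x ∷ xs} {ys} (x∉xs ∷ xs!) x∷xs⊆ys =
    ≤-trans (s≤s (Unique∧⊆⇒length≤ xs! xs⊆ys-x))
            (filter-notAll (¬? ∘ (_≟ x)) ys
              (Any.map (λ x≡y y≢x → y≢x (sym x≡y)) (x∷xs⊆ys (here refl))))
    where
    xs⊆ys-x : xs ⊆ filter (¬? ∘ (_≟ x)) ys
    xs⊆ys-x y∈xs = ∈-filter⁺ (¬? ∘ (_≟ x)) (x∷xs⊆ys (there y∈xs)) (All.lookup x∉xs y∈xs ∘ sym)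

Unique-map⁺-∈ : ∀ {a b} {A : Set a} {B : Set b} {f : A → B} {xs} →
  (∀ {x y} → x ∈ xs → y ∈ xs → f x ≡ f y → x ≡ y) → Unique xs → Unique (map f xs)
Unique-map⁺-∈ {xs = []} _ [] = []
Unique-map⁺-∈ {xs = x ∷ xs} f-inj (x∉xs ∷ xs!) =
  All.map⁺ (All.tabulate (λ y∈xs → All.lookup x∉xs y∈xs ∘ f-inj (here refl) (there y∈xs)))
  ∷ Unique-map⁺-∈ (λ x∈xs y∈xs → f-inj (there x∈xs) (there y∈xs)) xs!

length-allFin : ∀ n → length (allFin n) ≡ n
length-allFin n = length-tabulate (λ i → i)

Unique⇒length≤ : ∀ {n} {xs : List (Fin n)} → Unique xs → length xs ≤ n
Unique⇒length≤ {n} {xs} xs! =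
  subst (length xs ≤_) (length-allFin n) (Unique∧⊆⇒length≤ _≟_ xs! (λ {x} _ → ∈-allFin x))

allFinExcept : ∀ {n} → Fin n → List (Fin n)
allFinExcept {suc m} i = map (punchIn i) (allFin m)

allFinExcept-unique : ∀ {n} (i : Fin n) → Unique (allFinExcept i)
allFinExcept-unique {suc m} i = Unique.map⁺ (punchIn-injective i _ _) (Unique.allFin⁺ m)

length-allFinExcept : ∀ {n} (i : Fin n) → suc (length (allFinExcept i)) ≡ n
length-allFinExcept {suc m} i = cong suc (trans (length-map (punchIn i) (allFin m)) (length-allFin m))

∈-allFinExcept⁻ : ∀ {n} {i j : Fin n} → j ∈ allFinExcept i → j ≢ i
∈-allFinExcept⁻ {suc m} {i} j∈ with ∈-map⁻ (punchIn i) j∈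
... | k , _ , refl = punchInᵢ≢i i k

module _ {n : ℕ} where
  open import Data.List.Membership.DecPropositional (_≟_ {n}) using (_∈?_)

  outside : List (Fin n) → List (Fin n)
  outside ks = filter (λ x → ¬? (x ∈? ks)) (allFin n)

  outside-unique : ∀ ks → Unique (outside ks)
  outside-unique ks = Unique.filter⁺ (λ x → ¬? (x ∈? ks)) (Unique.allFin⁺ n)

  ∈-outside⁺ : ∀ {ks x} → x ∉ ks → x ∈ outside ks
  ∈-outside⁺ {ks} {x} = ∈-filter⁺ (λ x → ¬? (x ∈? ks)) (∈-allFin x)

  ∈-outside⁻ : ∀ {ks x} → x ∈ outside ks → x ∉ ks
  ∈-outside⁻ {ks} x∈ = proj₂ (∈-filter⁻ (λ x → ¬? (x ∈? ks)) {xs = allFin n} x∈)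

  length-outside : ∀ ks → Unique ks → length (outside ks) + length ks ≡ n
  length-outside ks ks! = ≤-antisym
    (subst (_≤ n) (length-++ (outside ks)) (Unique⇒length≤ (Unique.++⁺ (outside-unique ks) ks! disjoint)))
    (subst₂ _≤_ (length-allFin n) (length-++ (outside ks))
      (Unique∧⊆⇒length≤ _≟_ (Unique.allFin⁺ n) covers))
    where
    disjoint : ∀ {x} → ¬ (x ∈ outside ks × x ∈ ks)
    disjoint (x∈out , x∈ks) = ∈-outside⁻ x∈out x∈ks
    covers : allFin n ⊆ outside ks ++ ks
    covers {x} _ with x ∈? ks
    ... | yes x∈ks = ∈-++⁺ʳ (outside ks) x∈ks
    ... | no x∉ks = ∈-++⁺ˡ (∈-outside⁺ x∉ks)

  fresh : ∀ (ks : List (Fin n)) → length ks < n → ∃[ x ] x ∉ ks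
  fresh ks ks<n with All.all? (_∈? ks) (allFin n)
  ... | yes all∈ks = ⊥-elim (<⇒≱ ks<n (subst (_≤ length ks) (length-allFin n)
                       (Unique∧⊆⇒length≤ _≟_ (Unique.allFin⁺ n) (All.lookup all∈ks))))
  ... | no ¬all∈ks = Any.satisfied (All.¬All⇒Any¬ (_∈? ks) (allFin n) ¬all∈ks)

n∸3+4≰n : ∀ n → n ∸ 3 + 4 ≰ n
n∸3+4≰n n n∸3+4≤n =
  1+n≰n (≤-trans (s≤s (m≤n+m∸n n 3)) (subst (_≤ n) (+-comm (n ∸ 3) 4) n∸3+4≤n))

2*[m+3]∸6≡m+m : ∀ m → 2 * (m + 3) ∸ 6 ≡ m + m
2*[m+3]∸6≡m+m m = trans (cong (_∸ 6) (2*[m+3]≡m+m+6 m)) (m+n∸n≡m (m + m) 6)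
  where
  2*[m+3]≡m+m+6 : ∀ m → 2 * (m + 3) ≡ m + m + 6
  2*[m+3]≡m+m+6 = solve-∀

adj-irrefl : ∀ {n} (G : SimpleGraph n) {a b} → a ≡ b → adj G a b ≢ true
adj-irrefl G {a} refl a~a with () ← trans (sym a~a) (irrefl G a)

degree+length-non-neighbours≤ : ∀ {n} (G : SimpleGraph n) v {ns : List (Fin n)} →
  Unique ns → All (λ y → adj G v y ≢ true) ns → degree G v + length ns ≤ n
degree+length-non-neighbours≤ {n} G v {ns} ns! non-neighbours =
  subst (_≤ n) (length-++ neighbours)
    (Unique⇒length≤ (Unique.++⁺ (Unique.filter⁺ _ (Unique.allFin⁺ n)) ns! disjoint))
  where
  neighbours = filter (T? ∘ adj G v) (allFin n)
  disjoint : ∀ {y} → ¬ (y ∈ neighbours × y ∈ ns)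
  disjoint (y∈nbrs , y∈ns) = All.lookup non-neighbours y∈ns
    (Equivalence.to T-≡ (proj₂ (∈-filter⁻ (T? ∘ adj G v) {xs = allFin n} y∈nbrs)))

module _ {G : Graph} {P : V G → Set} where

  walkIn-start : ∀ {x y k} → WalkIn G P x y k → P x
  walkIn-start (nil px) = px
  walkIn-start (cons px _ _) = px

  walkIn-stuck : ∀ {x y k} → (∀ {z} → Adj G x z → ¬ P z) → WalkIn G P x y k → y ≡ x
  walkIn-stuck _ (nil _) = refl
  walkIn-stuck dead-end (cons _ x~z w) = ⊥-elim (dead-end x~z (walkIn-start w))

  walkIn-++ : ∀ {x y z k m} → WalkIn G P x y k → WalkIn G P y z m → WalkIn G P x z (k + m)
  walkIn-++ (nil _) w′ = w′
  walkIn-++ (cons px x~y w) w′ = cons px x~y (walkIn-++ w w′)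

  walkIn-∷ʳ : ∀ {x y z k} → WalkIn G P x y k → Adj G y z → P z → WalkIn G P x z (suc k)
  walkIn-∷ʳ (nil py) y~z pz = cons py y~z (nil pz)
  walkIn-∷ʳ (cons px x~y w) y~z pz = cons px x~y (walkIn-∷ʳ w y~z pz)

  walkIn-reverse : (∀ {x y} → Adj G x y → Adj G y x) → ∀ {x y k} → WalkIn G P x y k → WalkIn G P y x k
  walkIn-reverse Adj-sym (nil px) = nil px
  walkIn-reverse Adj-sym (cons px x~y w) = walkIn-∷ʳ (walkIn-reverse Adj-sym w) (Adj-sym x~y) px

outerConnected-via : ∀ {G : Graph} {D : List (V G)} → (∀ {x y} → Adj G x y → Adj G y x) → (c : V G) →
  (∀ x → x ∉ D → ∃[ k ] WalkIn G (_∉ D) x c k) → OuterConnected G D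
outerConnected-via Adj-sym c reach x y x∉D y∉D with reach x x∉D | reach y y∉D
... | k , x⇝c | m , y⇝c = k + m , walkIn-++ x⇝c (walkIn-reverse Adj-sym y⇝c)

module MiddleGraph {n} (G : SimpleGraph n) where

  MAdj-sym : ∀ {x y} → MAdj G x y → MAdj G y x
  MAdj-sym {inj₁ _} {inj₂ _} x∈e = x∈e
  MAdj-sym {inj₂ _} {inj₁ _} x∈e = x∈e
  MAdj-sym {inj₂ _} {inj₂ _} (e≢f , x , x∈e , x∈f) = e≢f ∘ sym , x , x∈f , x∈e

  Edge-≡ : ∀ {e f : Edge G} → proj₁ e ≡ proj₁ f → e ≡ f
  Edge-≡ {_ , u<v , u~v} {_ , u<v′ , u~v′} refl =
    cong₂ (λ p q → _ , p , q) (<-irrelevant u<v u<v′) (Decidable⇒UIP.≡-irrelevant Bool._≟_ u~v u~v′)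

  _≟ᴱ_ : DecidableEquality (Edge G)
  e ≟ᴱ f = map′ Edge-≡ (cong proj₁) (Product.≡-dec _≟_ _≟_ (proj₁ e) (proj₁ f))

  _≟ᴹ_ : DecidableEquality (V (Middle G))
  _≟ᴹ_ = Sum.≡-dec _≟_ _≟ᴱ_

  data Joins (e : Edge G) (a b : Fin n) : Set where
    forward  : proj₁ e ≡ (a , b) → Joins e a b
    backward : proj₁ e ≡ (b , a) → Joins e a b

  Joins-sym : ∀ {e a b} → Joins e a b → Joins e b a
  Joins-sym (forward e=ab) = backward e=ab
  Joins-sym (backward e=ba) = forward e=ba

  Joins⇒incident : ∀ {e a b} → Joins e a b → Incident {G = G} a e
  Joins⇒incident (forward refl) = inj₁ refl
  Joins⇒incident (backward refl) = inj₂ refl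

  Joins-incident⁻ : ∀ {e a b x} → Joins e a b → Incident {G = G} x e → x ≡ a ⊎ x ≡ b
  Joins-incident⁻ (forward refl) x∈e = x∈e
  Joins-incident⁻ (backward refl) (inj₁ x≡b) = inj₂ x≡b
  Joins-incident⁻ (backward refl) (inj₂ x≡a) = inj₁ x≡a

  Joins-unique : ∀ {e f a b} → Joins e a b → Joins f a b → e ≡ f
  Joins-unique (forward e=ab) (forward f=ab) = Edge-≡ (trans e=ab (sym f=ab))
  Joins-unique (backward e=ba) (backward f=ba) = Edge-≡ (trans e=ba (sym f=ba))
  Joins-unique {_ , a<b , _} {_ , b<a , _} (forward refl) (backward refl) = ⊥-elim (<-asym a<b b<a)
  Joins-unique {_ , b<a , _} {_ , a<b , _} (backward refl) (forward refl) = ⊥-elim (<-asym a<b b<a)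

  incident⇒Joins : ∀ {x e} → Incident {G = G} x e → ∃[ y ] (adj G x y ≡ true × Joins e x y)
  incident⇒Joins {e = (_ , v) , _ , u~v} (inj₁ refl) = v , u~v , forward refl
  incident⇒Joins {e = (u , _) , _ , u~v} (inj₂ refl) = u , trans (adj-sym G _ u) u~v , backward refl

  edge : ∀ {a b} → adj G a b ≡ true → Edge G
  edge {a} {b} a~b with <-cmp a b
  ... | tri< a<b _ _ = (a , b) , a<b , a~b
  ... | tri≈ _ a≡b _ = ⊥-elim (adj-irrefl G a≡b a~b)
  ... | tri> _ _ b<a = (b , a) , b<a , trans (adj-sym G b a) a~b

  edge-Joins : ∀ {a b} (a~b : adj G a b ≡ true) → Joins (edge a~b) a b
  edge-Joins {a} {b} a~b with <-cmp a b
  ... | tri< _ _ _ = forward refl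
  ... | tri≈ _ a≡b _ = ⊥-elim (adj-irrefl G a≡b a~b)
  ... | tri> _ _ _ = backward refl

module PendantSet {n} (G : SimpleGraph n) (L : List (Fin n)) (pendantEdge : Fin n → Edge G)
  (L! : Unique L)
  (pendantEdge-unique : ∀ {x e} → x ∈ L → Incident {G = G} x e → e ≡ pendantEdge x)
  (pendantEdge-injective : ∀ {x y} → x ∈ L → y ∈ L → pendantEdge x ≡ pendantEdge y → x ≡ y) where

  open MiddleGraph G
  open import Data.List.Membership.DecPropositional _≟ᴹ_ using (_∈?_)

  pendantEdges : List (V (Middle G))
  pendantEdges = map (inj₂ ∘ pendantEdge) L

  pendantSet : List (V (Middle G))
  pendantSet = map inj₁ L ++ pendantEdges

  pendantEdges-unique : Unique pendantEdges
  pendantEdges-unique =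
    Unique-map⁺-∈ (λ x∈L y∈L → pendantEdge-injective x∈L y∈L ∘ inj₂-injective) L!

  pendantSet-unique : Unique pendantSet
  pendantSet-unique = Unique.++⁺ (Unique.map⁺ (inj₁-injective {B = Edge G}) L!) pendantEdges-unique disjoint
    where
    disjoint : ∀ {z} → ¬ (z ∈ map inj₁ L × z ∈ pendantEdges)
    disjoint (z∈vs , z∈es) with ∈-map⁻ inj₁ z∈vs | ∈-map⁻ (inj₂ ∘ pendantEdge) z∈es
    ... | _ , _ , refl | _ , _ , ()

  length-pendantSet : length pendantSet ≡ length L + length L
  length-pendantSet =
    trans (length-++ (map inj₁ L)) (cong₂ _+_ (length-map inj₁ L) (length-map (inj₂ ∘ pendantEdge) L))

  inj₁∈pendantSet⁺ : ∀ {x} → x ∈ L → inj₁ x ∈ pendantSet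
  inj₁∈pendantSet⁺ x∈L = ∈-++⁺ˡ (∈-map⁺ inj₁ x∈L)

  pendantEdge∈pendantSet : ∀ {x} → x ∈ L → inj₂ (pendantEdge x) ∈ pendantSet
  pendantEdge∈pendantSet x∈L = ∈-++⁺ʳ (map inj₁ L) (∈-map⁺ (inj₂ ∘ pendantEdge) x∈L)

  inj₁∈pendantSet⁻ : ∀ {x} → inj₁ x ∈ pendantSet → x ∈ L
  inj₁∈pendantSet⁻ z∈ with ∈-++⁻ (map inj₁ L) z∈
  ... | inj₁ z∈vs with ∈-map⁻ inj₁ z∈vs
  ...   | _ , x∈L , refl = x∈L
  inj₁∈pendantSet⁻ z∈ | inj₂ z∈es with ∈-map⁻ (inj₂ ∘ pendantEdge) z∈es
  ...   | _ , _ , ()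

  inj₂∈pendantSet⁻ : ∀ {e} → inj₂ e ∈ pendantSet → ∃[ x ] (x ∈ L × e ≡ pendantEdge x)
  inj₂∈pendantSet⁻ z∈ with ∈-++⁻ (map inj₁ L) z∈
  ... | inj₁ z∈vs with ∈-map⁻ inj₁ z∈vs
  ...   | _ , _ , ()
  inj₂∈pendantSet⁻ z∈ | inj₂ z∈es with ∈-map⁻ (inj₂ ∘ pendantEdge) z∈es
  ...   | x , x∈L , refl = x , x∈L , refl

  module _ {D : List (V (Middle G))} (dom : TotalDominating (Middle G) D) where

    pendantEdge∈dominating : ∀ {x} → x ∈ L → inj₂ (pendantEdge x) ∈ D
    pendantEdge∈dominating {x} x∈L with dom (inj₁ x)
    ... | inj₂ e , e∈D , x∈e = subst (λ f → inj₂ f ∈ D) (pendantEdge-unique x∈L x∈e) e∈D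

    pendantEdges⊆dominating : pendantEdges ⊆ D
    pendantEdges⊆dominating z∈es with ∈-map⁻ (inj₂ ∘ pendantEdge) z∈es
    ... | x , x∈L , refl = pendantEdge∈dominating x∈L

    pendantSet⊆dominating : All (λ x → inj₁ x ∈ D) L → pendantSet ⊆ D
    pendantSet⊆dominating L⊆D z∈ with ∈-++⁻ (map inj₁ L) z∈
    ... | inj₂ z∈es = pendantEdges⊆dominating z∈es
    ... | inj₁ z∈vs with ∈-map⁻ inj₁ z∈vs
    ...   | x , x∈L , refl = All.lookup L⊆D x∈L

    module _ (oc : OuterConnected (Middle G) D) {x} (x∈L : x ∈ L) (x∉D : inj₁ x ∉ D) where

      all-but-leaf∈dominating : ∀ z → z ≢ inj₁ x → z ∈ D
      all-but-leaf∈dominating z z≢x with z ∈? D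
      ... | yes z∈D = z∈D
      ... | no z∉D with oc (inj₁ x) z x∉D z∉D
      ...   | _ , x⇝z = ⊥-elim (z≢x (walkIn-stuck only-pendantEdge x⇝z))
        where
        only-pendantEdge : ∀ {y} → MAdj G (inj₁ x) y → ¬ (y ∉ D)
        only-pendantEdge {inj₂ e} x∈e e∉D =
          e∉D (subst (λ f → inj₂ f ∈ D) (sym (pendantEdge-unique x∈L x∈e)) (pendantEdge∈dominating x∈L))

      length-L+allFinExcept≤ : Unique D → length L + length (allFinExcept x) ≤ length D
      length-L+allFinExcept≤ D! = begin
        length L + length (allFinExcept x)
          ≡⟨ sym (cong₂ _+_ (length-map (inj₂ ∘ pendantEdge) L) (length-map inj₁ (allFinExcept x))) ⟩
        length pendantEdges + length others  ≡⟨ sym (length-++ pendantEdges) ⟩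
        length (pendantEdges ++ others)      ≤⟨ Unique∧⊆⇒length≤ _≟ᴹ_ unique ⊆D ⟩
        length D                             ∎
        where
        open ≤-Reasoning
        others : List (V (Middle G))
        others = map inj₁ (allFinExcept x)
        disjoint : ∀ {z} → ¬ (z ∈ pendantEdges × z ∈ others)
        disjoint (z∈es , z∈others) with ∈-map⁻ (inj₂ ∘ pendantEdge) z∈es | ∈-map⁻ inj₁ z∈others
        ... | _ , _ , refl | _ , _ , ()
        unique : Unique (pendantEdges ++ others)
        unique = Unique.++⁺ pendantEdges-unique
          (Unique.map⁺ (inj₁-injective {B = Edge G}) (allFinExcept-unique x)) disjoint
        ⊆D : pendantEdges ++ others ⊆ D
        ⊆D z∈ with ∈-++⁻ pendantEdges z∈
        ... | inj₁ z∈es = pendantEdges⊆dominating z∈es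
        ... | inj₂ z∈others with ∈-map⁻ inj₁ z∈others
        ...   | y , y∈others , refl =
          all-but-leaf∈dominating (inj₁ y) (∈-allFinExcept⁻ y∈others ∘ inj₁-injective)

  length-pendantSet≤ : length L < n → ∀ D → Unique D → IsTOCD (Middle G) D → length pendantSet ≤ length D
  length-pendantSet≤ L<n D D! (dom , oc) with All.all? (λ x → inj₁ x ∈? D) L
  ... | yes L⊆D = Unique∧⊆⇒length≤ _≟ᴹ_ pendantSet-unique (pendantSet⊆dominating dom L⊆D)
  ... | no ¬L⊆D with find (All.¬All⇒Any¬ (λ x → inj₁ x ∈? D) L ¬L⊆D)
  ...   | x , x∈L , x∉D = begin
    length pendantSet                    ≡⟨ length-pendantSet ⟩
    length L + length L                  ≤⟨ +-monoʳ-≤ (length L) L≤n-1 ⟩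
    length L + length (allFinExcept x)   ≤⟨ length-L+allFinExcept≤ dom oc x∈L x∉D D! ⟩
    length D                             ∎
    where
    open ≤-Reasoning
    L≤n-1 : length L ≤ length (allFinExcept x)
    L≤n-1 = s≤s⁻¹ (subst (suc (length L) ≤_) (sym (length-allFinExcept x)) L<n)

module Spider {n} (T : SimpleGraph n) (acyclic : ¬ HasCycle T) (n≥6 : 6 ≤ n)
  {v₁ v₂ v₃ v₄ v₅ : Fin n}
  (v₁~v₂ : adj T v₁ v₂ ≡ true) (v₂~v₃ : adj T v₂ v₃ ≡ true)
  (v₃~v₄ : adj T v₃ v₄ ≡ true) (v₄~v₅ : adj T v₄ v₅ ≡ true)
  (v₁≢v₂ : v₁ ≢ v₂) (v₁≢v₃ : v₁ ≢ v₃) (v₁≢v₄ : v₁ ≢ v₄) (v₁≢v₅ : v₁ ≢ v₅)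
  (v₂≢v₃ : v₂ ≢ v₃) (v₂≢v₄ : v₂ ≢ v₄) (v₂≢v₅ : v₂ ≢ v₅)
  (v₃≢v₄ : v₃ ≢ v₄) (v₃≢v₅ : v₃ ≢ v₅) (v₄≢v₅ : v₄ ≢ v₅)
  (degree-v₃ : degree T v₃ ≡ n ∸ 3) where

  open MiddleGraph T
  open import Data.List.Membership.DecPropositional (_≟_ {n}) using (_∈?_)

  infix 4 _~_
  _~_ : Fin n → Fin n → Set
  x ~ y = adj T x y ≡ true

  ~-sym : ∀ {x y} → x ~ y → y ~ x
  ~-sym {x} {y} x~y = trans (adj-sym T y x) x~y

  ~⇒≢ : ∀ {x y} → x ~ y → x ≢ y
  ~⇒≢ x~y x≡y = adj-irrefl T x≡y x~y

  no-triangle : ∀ {x y z} → x ~ y → y ~ z → z ~ x → ⊥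
  no-triangle {x} x~y y~z z~x = acyclic (x , _ ∷ _ ∷ [] , s≤s (s≤s z≤n) ,
    (~⇒≢ x~y ∷ (~⇒≢ z~x ∘ sym) ∷ []) ∷ (~⇒≢ y~z ∷ []) ∷ [] ∷ [] ,
    step x~y (step y~z (step z~x (single x))))

  no-square : ∀ {w x y z} → w ≢ y → x ≢ z → w ~ x → x ~ y → y ~ z → z ~ w → ⊥
  no-square {w} w≢y x≢z w~x x~y y~z z~w = acyclic (w , _ ∷ _ ∷ _ ∷ [] , s≤s (s≤s z≤n) ,
    (~⇒≢ w~x ∷ w≢y ∷ (~⇒≢ z~w ∘ sym) ∷ []) ∷ (~⇒≢ x~y ∷ x≢z ∷ []) ∷ (~⇒≢ y~z ∷ []) ∷ []
      ∷ [] ,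
    step w~x (step x~y (step y~z (step z~w (single w)))))

  ¬v₅~v₁ : ¬ v₅ ~ v₁
  ¬v₅~v₁ v₅~v₁ = acyclic (v₁ , v₂ ∷ v₃ ∷ v₄ ∷ v₅ ∷ [] , s≤s (s≤s z≤n) ,
    (v₁≢v₂ ∷ v₁≢v₃ ∷ v₁≢v₄ ∷ v₁≢v₅ ∷ []) ∷ (v₂≢v₃ ∷ v₂≢v₄ ∷ v₂≢v₅ ∷ []) ∷ (v₃≢v₄ ∷ v₃≢v₅ ∷ [])
      ∷ (v₄≢v₅ ∷ []) ∷ [] ∷ [] ,
    step v₁~v₂ (step v₂~v₃ (step v₃~v₄ (step v₄~v₅ (step v₅~v₁ (single v₁))))))

  v₃~other : ∀ {x} → x ≢ v₁ → x ≢ v₃ → x ≢ v₅ → v₃ ~ x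
  v₃~other {x} x≢v₁ x≢v₃ x≢v₅ with adj T v₃ x Bool.≟ true
  ... | yes v₃~x = v₃~x
  ... | no ¬v₃~x = ⊥-elim (n∸3+4≰n n (subst (λ d → d + 4 ≤ n) degree-v₃
                     (degree+length-non-neighbours≤ T v₃ distinct non-neighbours)))
    where
    distinct : Unique (v₁ ∷ v₃ ∷ v₅ ∷ x ∷ [])
    distinct = (v₁≢v₃ ∷ v₁≢v₅ ∷ (x≢v₁ ∘ sym) ∷ []) ∷ (v₃≢v₅ ∷ (x≢v₃ ∘ sym) ∷ [])
             ∷ ((x≢v₅ ∘ sym) ∷ []) ∷ [] ∷ []
    non-neighbours : All (λ y → ¬ v₃ ~ y) (v₁ ∷ v₃ ∷ v₅ ∷ x ∷ [])
    non-neighbours = (λ v₃~v₁ → no-triangle v₁~v₂ v₂~v₃ v₃~v₁) ∷ adj-irrefl T refl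
                   ∷ (λ v₃~v₅ → no-triangle v₃~v₄ v₄~v₅ (~-sym v₃~v₅)) ∷ ¬v₃~x ∷ []

  v₁~⇒≡v₂ : ∀ {y} → v₁ ~ y → y ≡ v₂
  v₁~⇒≡v₂ {y} v₁~y with y ≟ v₂ | y ≟ v₃ | y ≟ v₅
  ... | yes y≡v₂ | _        | _        = y≡v₂
  ... | no _     | yes refl | _        = ⊥-elim (no-triangle v₁~v₂ v₂~v₃ (~-sym v₁~y))
  ... | no _     | no _     | yes refl = ⊥-elim (¬v₅~v₁ (~-sym v₁~y))
  ... | no y≢v₂  | no y≢v₃  | no y≢v₅  =
    ⊥-elim (no-square v₁≢v₃ (y≢v₂ ∘ sym) v₁~v₂ v₂~v₃ (v₃~other (~⇒≢ v₁~y ∘ sym) y≢v₃ y≢v₅) (~-sym v₁~y))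

  v₅~⇒≡v₄ : ∀ {y} → v₅ ~ y → y ≡ v₄
  v₅~⇒≡v₄ {y} v₅~y with y ≟ v₄ | y ≟ v₃ | y ≟ v₁
  ... | yes y≡v₄ | _        | _        = y≡v₄
  ... | no _     | yes refl | _        = ⊥-elim (no-triangle v₃~v₄ v₄~v₅ v₅~y)
  ... | no _     | no _     | yes refl = ⊥-elim (¬v₅~v₁ v₅~y)
  ... | no y≢v₄  | no y≢v₃  | no y≢v₁  =
    ⊥-elim (no-square (v₃≢v₅ ∘ sym) (y≢v₄ ∘ sym) (~-sym v₄~v₅) (~-sym v₃~v₄)
                      (v₃~other y≢v₁ y≢v₃ (~⇒≢ v₅~y ∘ sym)) (~-sym v₅~y))

  -- The parent in T rooted at v₃, except that v₃ is given the parent v₂: then every vertex is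
  -- adjacent to its parent, and every edge joins a vertex to its parent.
  parent : Fin n → Fin n
  parent x with x ≟ v₁ | x ≟ v₃ | x ≟ v₅
  ... | yes _ | _     | _     = v₂
  ... | no _  | yes _ | _     = v₂
  ... | no _  | no _  | yes _ = v₄
  ... | no _  | no _  | no _  = v₃

  parent-v₁ : parent v₁ ≡ v₂
  parent-v₁ with v₁ ≟ v₁
  ... | yes _ = refl
  ... | no v₁≢v₁ = ⊥-elim (v₁≢v₁ refl)

  parent-v₅ : parent v₅ ≡ v₄
  parent-v₅ with v₅ ≟ v₁ | v₅ ≟ v₃ | v₅ ≟ v₅
  ... | yes v₅≡v₁ | _         | _        = ⊥-elim (v₁≢v₅ (sym v₅≡v₁))
  ... | no _      | yes v₅≡v₃ | _        = ⊥-elim (v₃≢v₅ (sym v₅≡v₃))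
  ... | no _      | no _      | yes _    = refl
  ... | no _      | no _      | no v₅≢v₅ = ⊥-elim (v₅≢v₅ refl)

  parent-other : ∀ {x} → x ≢ v₁ → x ≢ v₃ → x ≢ v₅ → parent x ≡ v₃
  parent-other {x} x≢v₁ x≢v₃ x≢v₅ with x ≟ v₁ | x ≟ v₃ | x ≟ v₅
  ... | yes x≡v₁ | _        | _        = ⊥-elim (x≢v₁ x≡v₁)
  ... | no _     | yes x≡v₃ | _        = ⊥-elim (x≢v₃ x≡v₃)
  ... | no _     | no _     | yes x≡v₅ = ⊥-elim (x≢v₅ x≡v₅)
  ... | no _     | no _     | no _     = refl

  parent-adj : ∀ x → x ~ parent x
  parent-adj x with x ≟ v₁ | x ≟ v₃ | x ≟ v₅
  ... | yes refl | _        | _        = v₁~v₂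
  ... | no _     | yes refl | _        = ~-sym v₂~v₃
  ... | no _     | no _     | yes refl = ~-sym v₄~v₅
  ... | no x≢v₁  | no x≢v₃  | no x≢v₅  = ~-sym (v₃~other x≢v₁ x≢v₃ x≢v₅)

  spine : List (Fin n)
  spine = v₂ ∷ v₃ ∷ v₄ ∷ []

  parent∈spine : ∀ x → parent x ∈ spine
  parent∈spine x with x ≟ v₁ | x ≟ v₃ | x ≟ v₅
  ... | yes _ | _     | _     = here refl
  ... | no _  | yes _ | _     = here refl
  ... | no _  | no _  | yes _ = there (there (here refl))
  ... | no _  | no _  | no _  = there (here refl)

  -- The case split happens in a helper, since matching on x ≟ v₁ directly would also rewrite parent x.
  adj⇒parent : ∀ {x y} → x ~ y → y ≡ parent x ⊎ x ≡ parent y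
  adj⇒parent {x} {y} x~y = go (x ≟ v₁) (x ≟ v₅) (y ≟ v₁) (y ≟ v₅) (x ≟ v₃) (y ≟ v₃)
    where
    v₁-parent : ∀ {a b} → a ≡ v₁ → a ~ b → b ≡ parent a
    v₁-parent refl a~b = trans (v₁~⇒≡v₂ a~b) (sym parent-v₁)
    v₅-parent : ∀ {a b} → a ≡ v₅ → a ~ b → b ≡ parent a
    v₅-parent refl a~b = trans (v₅~⇒≡v₄ a~b) (sym parent-v₅)
    go : Dec (x ≡ v₁) → Dec (x ≡ v₅) → Dec (y ≡ v₁) → Dec (y ≡ v₅) → Dec (x ≡ v₃) → Dec (y ≡ v₃) →
         y ≡ parent x ⊎ x ≡ parent y
    go (yes x≡v₁) _ _ _ _ _ = inj₁ (v₁-parent x≡v₁ x~y)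
    go _ (yes x≡v₅) _ _ _ _ = inj₁ (v₅-parent x≡v₅ x~y)
    go _ _ (yes y≡v₁) _ _ _ = inj₂ (v₁-parent y≡v₁ (~-sym x~y))
    go _ _ _ (yes y≡v₅) _ _ = inj₂ (v₅-parent y≡v₅ (~-sym x~y))
    go _ _ (no y≢v₁) (no y≢v₅) (yes x≡v₃) _ =
      inj₂ (trans x≡v₃ (sym (parent-other y≢v₁ (λ y≡v₃ → ~⇒≢ x~y (trans x≡v₃ (sym y≡v₃))) y≢v₅)))
    go (no x≢v₁) (no x≢v₅) _ _ _ (yes y≡v₃) =
      inj₁ (trans y≡v₃ (sym (parent-other x≢v₁ (λ x≡v₃ → ~⇒≢ x~y (trans x≡v₃ (sym y≡v₃))) x≢v₅)))
    go (no x≢v₁) (no x≢v₅) (no y≢v₁) (no y≢v₅) (no x≢v₃) (no y≢v₃) =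
      ⊥-elim (no-triangle x~y (~-sym (v₃~other y≢v₁ y≢v₃ y≢v₅)) (v₃~other x≢v₁ x≢v₃ x≢v₅))

  parentEdge : Fin n → Edge T
  parentEdge x = edge (parent-adj x)

  parentEdge-Joins : ∀ x → Joins (parentEdge x) x (parent x)
  parentEdge-Joins x = edge-Joins (parent-adj x)

  parentEdge-incident : ∀ x → Incident {G = T} x (parentEdge x)
  parentEdge-incident x = Joins⇒incident (parentEdge-Joins x)

  parentEdge-incident-parent : ∀ x → Incident {G = T} (parent x) (parentEdge x)
  parentEdge-incident-parent x = Joins⇒incident (Joins-sym (parentEdge-Joins x))

  edge≡parentEdge : ∀ e → ∃[ x ] e ≡ parentEdge x
  edge≡parentEdge ((u , v) , _ , u~v) with adj⇒parent u~v
  ... | inj₁ refl = u , Joins-unique (forward refl) (parentEdge-Joins u)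
  ... | inj₂ refl = v , Joins-unique (backward refl) (parentEdge-Joins v)

  incident-parentEdge-spine : ∀ {s x} → s ∈ spine → Incident {G = T} x (parentEdge s) → x ∈ spine
  incident-parentEdge-spine {s} s∈spine x∈e with Joins-incident⁻ (parentEdge-Joins s) x∈e
  ... | inj₁ refl = s∈spine
  ... | inj₂ refl = parent∈spine s

  parentEdge-spine≢leaf : ∀ {s x} → s ∈ spine → x ∉ spine → parentEdge s ≢ parentEdge x
  parentEdge-spine≢leaf {x = x} s∈spine x∉spine e-s≡e-x =
    x∉spine (incident-parentEdge-spine s∈spine (subst (Incident {G = T} x) (sym e-s≡e-x) (parentEdge-incident x)))

  parentEdge-unique : ∀ {x e} → x ∉ spine → Incident {G = T} x e → e ≡ parentEdge x
  parentEdge-unique {x} x∉spine x∈e with incident⇒Joins x∈e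
  ... | y , x~y , e-joins with adj⇒parent x~y
  ...   | inj₁ refl = Joins-unique e-joins (parentEdge-Joins x)
  ...   | inj₂ refl = ⊥-elim (x∉spine (parent∈spine y))

  parentEdge-injective : ∀ {x y} → x ∉ spine → parentEdge x ≡ parentEdge y → x ≡ y
  parentEdge-injective {x} {y} x∉spine e-x≡e-y
    with Joins-incident⁻ (parentEdge-Joins y) (subst (Incident {G = T} x) e-x≡e-y (parentEdge-incident x))
  ... | inj₁ x≡y = x≡y
  ... | inj₂ refl = ⊥-elim (x∉spine (parent∈spine y))

  leaves : List (Fin n)
  leaves = outside spine

  open PendantSet T leaves parentEdge (outside-unique spine) (parentEdge-unique ∘ ∈-outside⁻)
    (λ x∈leaves _ → parentEdge-injective (∈-outside⁻ x∈leaves)) public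

  length-leaves : length leaves + 3 ≡ n
  length-leaves = length-outside spine ((v₂≢v₃ ∷ v₂≢v₄ ∷ []) ∷ (v₃≢v₄ ∷ []) ∷ [] ∷ [])

  v₁∉spine : v₁ ∉ spine
  v₁∉spine (here v₁≡v₂) = v₁≢v₂ v₁≡v₂
  v₁∉spine (there (here v₁≡v₃)) = v₁≢v₃ v₁≡v₃
  v₁∉spine (there (there (here v₁≡v₄))) = v₁≢v₄ v₁≡v₄

  v₅∉spine : v₅ ∉ spine
  v₅∉spine (here v₅≡v₂) = v₂≢v₅ (sym v₅≡v₂)
  v₅∉spine (there (here v₅≡v₃)) = v₃≢v₅ (sym v₅≡v₃)
  v₅∉spine (there (there (here v₅≡v₄))) = v₄≢v₅ (sym v₅≡v₄)

  spine-parent : ∀ {s} → s ∈ spine → ∃[ x ] (x ∉ spine × parent x ≡ s)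
  spine-parent (here refl) = v₁ , v₁∉spine , parent-v₁
  spine-parent (there (here refl)) with fresh (v₁ ∷ spine ++ v₅ ∷ []) n≥6
  ... | w , w∉path = w , w∉path ∘ there ∘ ∈-++⁺ˡ ,
                     parent-other (w∉path ∘ here) (w∉path ∘ there ∘ there ∘ here)
                                  (w∉path ∘ there ∘ there ∘ there ∘ there ∘ here)
  spine-parent (there (there (here refl))) = v₅ , v₅∉spine , parent-v₅

  pendantSet-dominating : TotalDominating (Middle T) pendantSet
  pendantSet-dominating (inj₁ v) with v ∈? spine
  ... | no v∉spine =
    inj₂ (parentEdge v) , pendantEdge∈pendantSet (∈-outside⁺ v∉spine) , parentEdge-incident v
  ... | yes v∈spine with spine-parent v∈spine
  ...   | x , x∉spine , refl =
    inj₂ (parentEdge x) , pendantEdge∈pendantSet (∈-outside⁺ x∉spine) , parentEdge-incident-parent x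
  pendantSet-dominating (inj₂ e) with edge≡parentEdge e
  ... | x , refl with x ∈? spine
  ...   | no x∉spine = inj₁ x , inj₁∈pendantSet⁺ (∈-outside⁺ x∉spine) , parentEdge-incident x
  ...   | yes x∈spine with spine-parent x∈spine
  ...     | c , c∉spine , refl =
    inj₂ (parentEdge c) , pendantEdge∈pendantSet (∈-outside⁺ c∉spine) ,
    parentEdge-spine≢leaf x∈spine c∉spine ∘ Edge-≡ ,
    parent c , parentEdge-incident (parent c) , parentEdge-incident-parent c

  spine∉pendantSet : ∀ {s} → s ∈ spine → inj₁ s ∉ pendantSet
  spine∉pendantSet s∈spine s∈D = ∈-outside⁻ (inj₁∈pendantSet⁻ s∈D) s∈spine

  parentEdge-spine∉pendantSet : ∀ {s} → s ∈ spine → inj₂ (parentEdge s) ∉ pendantSet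
  parentEdge-spine∉pendantSet s∈spine e-s∈D with inj₂∈pendantSet⁻ e-s∈D
  ... | _ , x∈leaves , e-s≡e-x = parentEdge-spine≢leaf s∈spine (∈-outside⁻ x∈leaves) e-s≡e-x

  Reaches-v₃ : V (Middle T) → Set
  Reaches-v₃ z = ∃[ k ] WalkIn (Middle T) (_∉ pendantSet) z (inj₁ v₃) k

  spine-reaches-v₃ : ∀ {s} → s ∈ spine → Reaches-v₃ (inj₁ s)
  spine-reaches-v₃ {s} s∈spine with s ≟ v₃
  ... | yes refl = 0 , nil (spine∉pendantSet s∈spine)
  ... | no s≢v₃ = 2 , subst (λ t → WalkIn (Middle T) (_∉ pendantSet) (inj₁ s) (inj₁ t) 2) parent-s≡v₃
        (cons (spine∉pendantSet s∈spine) (parentEdge-incident s)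
          (cons (parentEdge-spine∉pendantSet s∈spine) (parentEdge-incident-parent s)
            (nil (spine∉pendantSet (parent∈spine s)))))
    where
    parent-s≡v₃ : parent s ≡ v₃
    parent-s≡v₃ = parent-other (λ { refl → v₁∉spine s∈spine }) s≢v₃ (λ { refl → v₅∉spine s∈spine })

  pendantSet-outerConnected : OuterConnected (Middle T) pendantSet
  pendantSet-outerConnected = outerConnected-via MAdj-sym (inj₁ v₃) reaches
    where
    reaches : ∀ z → z ∉ pendantSet → Reaches-v₃ z
    reaches (inj₁ v) v∉D with v ∈? spine
    ... | yes v∈spine = spine-reaches-v₃ v∈spine
    ... | no v∉spine = ⊥-elim (v∉D (inj₁∈pendantSet⁺ (∈-outside⁺ v∉spine)))
    reaches (inj₂ e) e∉D with edge≡parentEdge e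
    ... | x , refl with spine-reaches-v₃ (parent∈spine x)
    ...   | k , parent⇝v₃ = suc k , cons e∉D (parentEdge-incident-parent x) parent⇝v₃

proposition3p11 : (n : ℕ) (T : SimpleGraph n) → 6 ≤ n → IsTree T → Diam (toGraph T) 4 →
    (v₁ v₂ v₃ v₄ v₅ : Fin n) → IsLongestPath T (v₁ ∷ v₂ ∷ v₃ ∷ v₄ ∷ v₅ ∷ []) →
    degree T v₃ ≡ n ∸ 3 → GammaTC (Middle T) (2 * n ∸ 6)
proposition3p11 n T n≥6 (_ , acyclic) _ v₁ v₂ v₃ v₄ v₅
  ((step v₁~v₂ (step v₂~v₃ (step v₃~v₄ (step v₄~v₅ (single _)))) ,
    (v₁≢v₂ ∷ v₁≢v₃ ∷ v₁≢v₄ ∷ v₁≢v₅ ∷ []) ∷ (v₂≢v₃ ∷ v₂≢v₄ ∷ v₂≢v₅ ∷ []) ∷ (v₃≢v₄ ∷ v₃≢v₅ ∷ [])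
      ∷ (v₄≢v₅ ∷ []) ∷ [] ∷ []) , _)
  degree-v₃ =
  (pendantSet , pendantSet-unique , (pendantSet-dominating , pendantSet-outerConnected) , size) ,
  λ D D! D-tocd → subst (_≤ length D) size (length-pendantSet≤ leaves<n D D! D-tocd)
  where
  open Spider T acyclic n≥6 v₁~v₂ v₂~v₃ v₃~v₄ v₄~v₅
    v₁≢v₂ v₁≢v₃ v₁≢v₄ v₁≢v₅ v₂≢v₃ v₂≢v₄ v₂≢v₅ v₃≢v₄ v₃≢v₅ v₄≢v₅ degree-v₃
  size : length pendantSet ≡ 2 * n ∸ 6
  size = begin
    length pendantSet               ≡⟨ length-pendantSet ⟩
    length leaves + length leaves   ≡⟨ sym (2*[m+3]∸6≡m+m (length leaves)) ⟩
    2 * (length leaves + 3) ∸ 6     ≡⟨ cong (λ m → 2 * m ∸ 6) length-leaves ⟩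
    2 * n ∸ 6                       ∎
    where open ≡-Reasoning
  leaves<n : length leaves < n
  leaves<n = subst (length leaves <_) length-leaves (m<m+n (length leaves) (s≤s z≤n))
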